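{- Let $G$ be a finite connected reflexive graph and $L$ a lattice on $V(G)$ compatible with $G$. Then the Hasse diagram of $L$ is a subgraph of $G$: whenever $u$ covers $v$ in $L$, $u$ and $v$ are adjacent in $G$.
   Context: A lattice $L$ on the vertex set of a reflexive graph $G$ is compatible with $G$ if whenever $u\sim u'$ and $v\sim v'$ in $G$ we have $u\wedge v\sim u'\wedge v'$ and $u\vee v\sim u'\vee v'$. $u$ covers $v$ means $v<u$ and there is no $x$ with $v<x<u$. -}

module Defs where

open import Data.Nat using (ℕ)
open import Data.Fin using (Fin)
open import Data.Product using (_×_; ∃-syntax)
open import Relation.Nullary using (¬_)
open import Relation.Binary.PropositionalEquality using (_≡_)
open import Relation.Binary.Core using (Rel)
open import Relation.Binary.Construct.Closure.ReflexiveTransitive using (Star)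
open import Relation.Binary.Lattice.Structures using (IsLattice)

record ReflexiveGraph (n : ℕ) : Set₁ where
  field
    _~_    : Rel (Fin n) _
    ~-sym  : ∀ {u v} → u ~ v → v ~ u
    ~-refl : ∀ u → u ~ u

Connected : ∀ {n} → ReflexiveGraph n → Set
Connected {n} G = ∀ (u v : Fin n) → Star (ReflexiveGraph._~_ G) u v

record LatticeOn (n : ℕ) : Set₁ where
  field
    _≤_       : Rel (Fin n) _
    _∨_       : Fin n → Fin n → Fin n
    _∧_       : Fin n → Fin n → Fin n
    isLattice : IsLattice _≡_ _≤_ _∨_ _∧_

  _<_ : Rel (Fin n) _
  x < y = x ≤ y × ¬ (x ≡ y)

  _covers_ : Rel (Fin n) _
  u covers v = v < u × ¬ (∃[ x ] (v < x × x < u))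

Compatible : ∀ {n} → ReflexiveGraph n → LatticeOn n → Set
Compatible G L =
  ∀ {u u' v v'} → u ~ u' → v ~ v' → ((u ∧ v) ~ (u' ∧ v')) × ((u ∨ v) ~ (u' ∨ v'))
  where
    open ReflexiveGraph G
    open LatticeOn L

-- The map x ↦ (x ∨ v) ∧ u retracts the vertex set onto the interval [v, u], and by
-- compatibility it sends edges to edges. When u covers v this interval is just {v, u}.
-- A walk from v to u in G contains an edge x ~ y with x mapped to v and y not, hence
-- y mapped to u; the image of that edge is the edge v ~ u.
module Submission where

open import Defs
open import Data.Nat using (ℕ)
open import Data.Fin using (Fin; _≟_)
open import Data.Empty using (⊥-elim)
open import Data.Product using (_×_; _,_; proj₁; proj₂; ∃₂)
open import Data.Sum using (_⊎_; inj₁; inj₂)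
open import Relation.Nullary using (¬_; yes; no)
open import Relation.Unary using (Pred; Decidable)
open import Relation.Binary.Core using (Rel)
open import Relation.Binary.PropositionalEquality using (_≡_; sym; trans; subst₂)
open import Relation.Binary.Construct.Closure.ReflexiveTransitive using (Star; ε; _◅_)
open import Relation.Binary.Lattice.Structures using (IsLattice)

Star-crossing : ∀ {a r p} {A : Set a} {R : Rel A r} {P : Pred A p} → Decidable P →
                ∀ {x y} → P x → ¬ P y → Star R x y → ∃₂ λ s t → P s × ¬ P t × R s t
Star-crossing P? px ¬py ε = ⊥-elim (¬py px)
Star-crossing P? {x} px ¬py (_◅_ {j = z} xRz z⋆y) with P? z
... | yes pz  = Star-crossing P? pz ¬py z⋆y
... | no ¬pz  = x , z , px , ¬pz , xRz

module Interval {n : ℕ} (L : LatticeOn n) where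
  open LatticeOn L
  open IsLattice isLattice using (antisym; x≤x∨y; y≤x∨y; ∨-least; x∧y≤x; x∧y≤y; ∧-greatest)
    renaming (refl to ≤-refl; trans to ≤-trans)

  clamp : Fin n → Fin n → Fin n → Fin n
  clamp v u x = (x ∨ v) ∧ u

  clamp-lower : ∀ {v u} x → v ≤ u → v ≤ clamp v u x
  clamp-lower {v} x v≤u = ∧-greatest (y≤x∨y x v) v≤u

  clamp-upper : ∀ {v u} x → clamp v u x ≤ u
  clamp-upper {v} {u} x = x∧y≤y (x ∨ v) u

  clamp-fixes : ∀ {v u x} → v ≤ x → x ≤ u → clamp v u x ≡ x
  clamp-fixes {v} {u} {x} v≤x x≤u =
    antisym (≤-trans (x∧y≤x (x ∨ v) u) (∨-least ≤-refl v≤x)) (∧-greatest (x≤x∨y x v) x≤u)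

  covers⇒interval-endpoints : ∀ {v u x} → u covers v → v ≤ x → x ≤ u → x ≡ v ⊎ x ≡ u
  covers⇒interval-endpoints {v} {u} {x} (_ , nothing-between) v≤x x≤u with x ≟ v | x ≟ u
  ... | yes x≡v | _       = inj₁ x≡v
  ... | no _    | yes x≡u = inj₂ x≡u
  ... | no x≢v  | no x≢u  = ⊥-elim (nothing-between (x , (v≤x , λ v≡x → x≢v (sym v≡x)) , (x≤u , x≢u)))

  covers⇒clamp-endpoints : ∀ {v u} → u covers v → ∀ x → clamp v u x ≡ v ⊎ clamp v u x ≡ u
  covers⇒clamp-endpoints cov@((v≤u , _) , _) x =
    covers⇒interval-endpoints cov (clamp-lower x v≤u) (clamp-upper x)

clamp-preserves-~ : ∀ {n} (G : ReflexiveGraph n) (L : LatticeOn n) → Compatible G L →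
                    ∀ v u {x y} → ReflexiveGraph._~_ G x y →
                    ReflexiveGraph._~_ G (Interval.clamp L v u x) (Interval.clamp L v u y)
clamp-preserves-~ G L compatible v u x~y =
  proj₁ (compatible (proj₂ (compatible x~y (~-refl v))) (~-refl u))
  where open ReflexiveGraph G

proposition2p5 : (n : ℕ) (G : ReflexiveGraph n) (L : LatticeOn n) →
    Connected G → Compatible G L →
    ∀ (u v : Fin n) → LatticeOn._covers_ L u v → ReflexiveGraph._~_ G u v
proposition2p5 n G L connected compatible u v cov@((v≤u , v≢u) , _) =
  ~-sym (crossing-edge⇒v~u (Star-crossing (λ x → clamp v u x ≟ v) clamp-v≡v clamp-u≢v (connected v u)))
  where
    open ReflexiveGraph G
    open LatticeOn L
    open Interval L
    open IsLattice isLattice using () renaming (refl to ≤-refl)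

    clamp-v≡v : clamp v u v ≡ v
    clamp-v≡v = clamp-fixes ≤-refl v≤u

    clamp-u≢v : ¬ clamp v u u ≡ v
    clamp-u≢v clamp-u≡v = v≢u (trans (sym clamp-u≡v) (clamp-fixes v≤u ≤-refl))

    crossing-edge⇒v~u : (∃₂ λ x y → clamp v u x ≡ v × ¬ clamp v u y ≡ v × x ~ y) → v ~ u
    crossing-edge⇒v~u (x , y , clamp-x≡v , clamp-y≢v , x~y)
      with covers⇒clamp-endpoints cov y
    ... | inj₁ clamp-y≡v = ⊥-elim (clamp-y≢v clamp-y≡v)
    ... | inj₂ clamp-y≡u = subst₂ _~_ clamp-x≡v clamp-y≡u (clamp-preserves-~ G L compatible v u x~y)
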